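{- Let $\mathcal{A}$ be an extensional $\mathbf{BI}(\_)^\bullet$-algebra and let $\mathcal{A}^\bullet=\{a^\bullet\mid a\in\mathcal{A}\}$. Then $\mathcal{A}^\bullet$, with application $x\cdot_{\mathcal{A}^\bullet}y=y\circ x\circ\mathbf{B}$, combinators $\mathbf{B}_{\mathcal{A}^\bullet}=\mathbf{B}^\bullet$, $\mathbf{I}_{\mathcal{A}^\bullet}=\mathbf{I}^\bullet$, and bullet operation $x\mapsto x^\bullet$ (the restriction of that of $\mathcal{A}$), is a $\mathbf{BI}(\_)^\bullet$-algebra, and it is isomorphic to $\mathcal{A}$ via $a\mapsto a^\bullet:\mathcal{A}\to\mathcal{A}^\bullet$ with inverse $b\mapsto b\,\mathbf{I}:\mathcal{A}^\bullet\to\mathcal{A}$.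
   Context: An applicative structure is a set $\mathcal{A}$ with a binary operation written by juxtaposition, associating to the left. A $\mathbf{BI}(\_)^\bullet$-algebra is an applicative structure with elements $\mathbf{B},\mathbf{I}$ and a function $a\mapsto a^\bullet$ such that $\mathbf{I}\,a=a$, $\mathbf{B}\,a\,b\,c=a\,(b\,c)$, $a^\bullet\,b=b\,a$ for all $a,b,c$. It is extensional if moreover: $\mathbf{B}\,\mathbf{I}=\mathbf{I}$; $(a\,b)^\bullet=\mathbf{B}\,b^\bullet\,(\mathbf{B}\,a^\bullet\,\mathbf{B})$; $\mathbf{B}\,\mathbf{B}^\bullet\,(\mathbf{B}\,\mathbf{B}\,(\mathbf{B}\,\mathbf{B}\,\mathbf{B}))=\mathbf{B}\,(\mathbf{B}\,\mathbf{B})\,\mathbf{B}$; $\mathbf{B}\,\mathbf{I}^\bullet\,\mathbf{B}=\mathbf{I}$; $\mathbf{B}\,a^{\bullet\bullet}\,\mathbf{B}=\mathbf{B}\,(\mathbf{B}\,a^\bullet)\,\mathbf{B}$ for all $a,b$. Write $a\circ b=\mathbf{B}\,a\,b$; in an extensional $\mathbf{BI}(\_)^\bullet$-algebra $\circ$ is associative, so iterated composites need no brackets. An isomorphism of $\mathbf{BI}(\_)^\bullet$-algebras is a bijection preserving application, $\mathbf{B}$, $\mathbf{I}$ and $(\_)^\bullet$. -}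

module Defs where

open import Level using (Level; _⊔_) renaming (suc to lsuc)
open import Relation.Binary.PropositionalEquality using (_≡_)
open import Data.Product using (∃; ∃-syntax)

record BIAlgebra (ℓ : Level) : Set (lsuc ℓ) where
  infixl 9 _·_
  infix 20 _•
  field
    Carrier : Set ℓ
    _·_     : Carrier → Carrier → Carrier
    _•      : Carrier → Carrier
    B       : Carrier
    I       : Carrier
    I-law   : ∀ a → I · a ≡ a
    B-law   : ∀ a b c → B · a · b · c ≡ a · (b · c)
    •-law   : ∀ a b → (a •) · b ≡ b · a

  _∘_ : Carrier → Carrier → Carrier
  a ∘ b = B · a · b
  infixr 8 _∘_

record IsExtensional {ℓ : Level} (𝒜 : BIAlgebra ℓ) : Set ℓ where
  open BIAlgebra 𝒜
  field
    ext-BI   : B · I ≡ I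
    ext-•app : ∀ a b → (a · b) • ≡ B · (b •) · (B · (a •) · B)
    ext-B•   : B · (B •) · (B · B · (B · B · B)) ≡ B · (B · B) · B
    ext-I•   : B · (I •) · B ≡ I
    ext-••   : ∀ a → B · ((a •) •) · B ≡ B · (B · (a •)) · B

-- A BI(_)•-algebra structure carried by the subset {x | P x} of a type X,
-- with the given operations on X restricted to that subset: the subset is
-- closed under the operations and the BI(_)•-axioms hold on its elements.
record IsBIAlgebraOn {ℓ ℓ' : Level} {X : Set ℓ} (P : X → Set ℓ')
       (app : X → X → X) (b i : X) (bul : X → X) : Set (ℓ ⊔ ℓ') where
  field
    app-closed : ∀ x y → P x → P y → P (app x y)
    b-in       : P b
    i-in       : P i
    bul-closed : ∀ x → P x → P (bul x)
    I-law      : ∀ x → P x → app i x ≡ x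
    B-law      : ∀ x y z → P x → P y → P z →
                 app (app (app b x) y) z ≡ app x (app y z)
    •-law      : ∀ x y → P x → P y → app (bul x) y ≡ app y x

module _ {ℓ : Level} (𝒜 : BIAlgebra ℓ) where
  open BIAlgebra 𝒜

  In• : Carrier → Set ℓ
  In• x = ∃[ a ] (x ≡ a •)

  app• : Carrier → Carrier → Carrier
  app• x y = y ∘ x ∘ B

  B•' : Carrier
  B•' = B •

  I•' : Carrier
  I•' = I •

  bul• : Carrier → Carrier
  bul• x = x •

record IsIsoOnto {ℓ ℓ' : Level} (𝒜 : BIAlgebra ℓ)
       {X : Set ℓ} (P : X → Set ℓ')
       (app : X → X → X) (b i : X) (bul : X → X)
       (f : BIAlgebra.Carrier 𝒜 → X) (g : X → BIAlgebra.Carrier 𝒜)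
       : Set (ℓ ⊔ ℓ') where
  open BIAlgebra 𝒜
  field
    f-into   : ∀ a → P (f a)
    g∘f      : ∀ a → g (f a) ≡ a
    f∘g      : ∀ x → P x → f (g x) ≡ x
    f-app    : ∀ a c → f (a · c) ≡ app (f a) (f c)
    f-B      : f B ≡ b
    f-I      : f I ≡ i
    f-•      : ∀ a → f (a •) ≡ bul (f a)

{-# OPTIONS --safe #-}
-- Extensionality axiom (a b)• = B b• (B a• B) says exactly that a ↦ a• turns
-- application into x ·• y = y ∘ x ∘ B.  So a ↦ a• is a homomorphism onto its
-- image A•, and the image of any homomorphism carries the transported
-- BI(_)•-structure; b ↦ b I is a left inverse because a• I = I a = a.
module Submission where

open import Level using (Level)
open import Data.Product using (_×_; _,_; ∃-syntax)
open import Relation.Binary.PropositionalEquality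
  using (_≡_; refl; sym; trans; cong; module ≡-Reasoning)
open import Defs

module HomomorphicImage
  {ℓ : Level} (𝒜 : BIAlgebra ℓ) {X : Set ℓ}
  (app : X → X → X) (b i : X) (bul : X → X)
  (f : BIAlgebra.Carrier 𝒜 → X)
  where
  open BIAlgebra 𝒜

  Image : X → Set ℓ
  Image x = ∃[ a ] (x ≡ f a)

  module _
    (f-app : ∀ a c → f (a · c) ≡ app (f a) (f c))
    (f-B : f B ≡ b) (f-I : f I ≡ i) (f-• : ∀ a → f (a •) ≡ bul (f a))
    where
    open ≡-Reasoning

    image-isBIAlgebraOn : IsBIAlgebraOn Image app b i bul
    image-isBIAlgebraOn = record
      { app-closed = λ { _ _ (a , refl) (c , refl) → a · c , sym (f-app a c) }
      ; b-in       = B , sym f-B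
      ; i-in       = I , sym f-I
      ; bul-closed = λ { _ (a , refl) → a • , sym (f-• a) }
      ; I-law      = λ { _ (a , refl) → image-I-law a }
      ; B-law      = λ { _ _ _ (x , refl) (y , refl) (z , refl) → image-B-law x y z }
      ; •-law      = λ { _ _ (a , refl) (c , refl) → image-•-law a c }
      }
      where
      image-I-law : ∀ a → app i (f a) ≡ f a
      image-I-law a = begin
        app i (f a)     ≡⟨ cong (λ w → app w (f a)) (sym f-I) ⟩
        app (f I) (f a) ≡⟨ sym (f-app I a) ⟩
        f (I · a)       ≡⟨ cong f (I-law a) ⟩
        f a             ∎

      image-B-law : ∀ x y z →
        app (app (app b (f x)) (f y)) (f z) ≡ app (f x) (app (f y) (f z))
      image-B-law x y z = begin
        app (app (app b (f x)) (f y)) (f z)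
          ≡⟨ cong (λ w → app (app (app w (f x)) (f y)) (f z)) (sym f-B) ⟩
        app (app (app (f B) (f x)) (f y)) (f z)
          ≡⟨ cong (λ w → app (app w (f y)) (f z)) (sym (f-app B x)) ⟩
        app (app (f (B · x)) (f y)) (f z)
          ≡⟨ cong (λ w → app w (f z)) (sym (f-app (B · x) y)) ⟩
        app (f (B · x · y)) (f z)
          ≡⟨ sym (f-app (B · x · y) z) ⟩
        f (B · x · y · z)
          ≡⟨ cong f (B-law x y z) ⟩
        f (x · (y · z))
          ≡⟨ f-app x (y · z) ⟩
        app (f x) (f (y · z))
          ≡⟨ cong (app (f x)) (f-app y z) ⟩
        app (f x) (app (f y) (f z))
          ∎

      image-•-law : ∀ a c → app (bul (f a)) (f c) ≡ app (f c) (f a)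
      image-•-law a c = begin
        app (bul (f a)) (f c) ≡⟨ cong (λ w → app w (f c)) (sym (f-• a)) ⟩
        app (f (a •)) (f c)   ≡⟨ sym (f-app (a •) c) ⟩
        f (a • · c)           ≡⟨ cong f (•-law a c) ⟩
        f (c · a)             ≡⟨ f-app c a ⟩
        app (f c) (f a)       ∎

    isIsoOnto-image : (g : X → Carrier) → (∀ a → g (f a) ≡ a) →
      IsIsoOnto 𝒜 Image app b i bul f g
    isIsoOnto-image g g∘f = record
      { f-into = λ a → a , refl
      ; g∘f    = g∘f
      ; f∘g    = λ { _ (a , refl) → cong f (g∘f a) }
      ; f-app  = f-app
      ; f-B    = f-B
      ; f-I    = f-I
      ; f-•    = f-•
      }

module _ {ℓ : Level} (𝒜 : BIAlgebra ℓ) where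
  open BIAlgebra 𝒜

  •-applied-to-I : ∀ a → a • · I ≡ a
  •-applied-to-I a = trans (•-law a I) (I-law a)

proposition3p4 : {ℓ : Level} (𝒜 : BIAlgebra ℓ) → IsExtensional 𝒜 →
    IsBIAlgebraOn (In• 𝒜) (app• 𝒜) (B•' 𝒜) (I•' 𝒜) (bul• 𝒜)
    × IsIsoOnto 𝒜 (In• 𝒜) (app• 𝒜) (B•' 𝒜) (I•' 𝒜) (bul• 𝒜)
        (λ a → BIAlgebra._• 𝒜 a) (λ b → BIAlgebra._·_ 𝒜 b (BIAlgebra.I 𝒜))
proposition3p4 𝒜 E =
    image-isBIAlgebraOn •-hom refl refl (λ _ → refl)
  , isIsoOnto-image •-hom refl refl (λ _ → refl) (λ x → x · I) (•-applied-to-I 𝒜)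
  where
  open BIAlgebra 𝒜
  open IsExtensional E using (ext-•app)
  open HomomorphicImage 𝒜 (app• 𝒜) (B•' 𝒜) (I•' 𝒜) (bul• 𝒜) _•

  •-hom : ∀ a c → (a · c) • ≡ app• 𝒜 (a •) (c •)
  •-hom = ext-•app
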